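{- Let $r=\frac{1-2z^2-\sqrt{1-4z^2}}{2z^2}$. The generating function, with respect to length, of zigzag knight's paths (ending on the $x$-axis, the empty path included) is $1+r(2+r)$. Consequently there are no such paths of odd length, and for every $n\ge0$ the number of zigzag knight's paths of length $2n$ is the Catalan number $\frac{1}{n+2}\binom{2n+2}{n+1}$ (so the generating function is $1+2z^2+5z^4+14z^6+42z^8+\cdots$).
   Context: Let $N=(1,2)$, $\bar N=(1,-2)$, $E=(2,1)$, $\bar E=(2,-1)$; $N,E$ are up-steps and $\bar N,\bar E$ are down-steps. A knight's path is a lattice path in $\mathbb N^2$ starting at $(0,0)$, ending on the $x$-axis, with steps in $\{N,\bar N,E,\bar E\}$. A zigzag knight's path is a knight's path in which consecutive steps alternate between up-steps and down-steps. The length of a path is its number of steps. -}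

module Defs where

open import Data.Nat using (ℕ; zero; suc; _+_; _*_; _/_)
open import Data.Nat.Combinatorics using (_C_)
open import Data.Integer as ℤ using (ℤ; +_; -[1+_])
open import Data.Bool using (Bool; true; false)
open import Data.Vec using (Vec; []; _∷_)
open import Data.Product using (_×_)
open import Data.Unit using (⊤)
open import Relation.Binary.PropositionalEquality using (_≡_; _≢_)

data Step : Set where
  N N̄ E Ē : Step

dy : Step → ℤ
dy N  = + 2
dy N̄  = -[1+ 1 ]
dy E  = + 1
dy Ē  = -[1+ 0 ]

dx : Step → ℕ
dx N  = 1
dx N̄  = 1
dx E  = 2
dx Ē  = 2

isUp : Step → Bool
isUp N  = true
isUp N̄  = false
isUp E  = true
isUp Ē  = false

-- Starting at a point of height h (the x-coordinate is always ≥ 0 since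
-- every step increases it), the steps keep the path in ℕ² (every visited
-- point has height ≥ 0) and the path ends on the x-axis (height 0).
StaysAboveEndsOnAxis : ∀ {m} → ℤ → Vec Step m → Set
StaysAboveEndsOnAxis h []       = h ≡ + 0
StaysAboveEndsOnAxis h (s ∷ ss) =
  (+ 0 ℤ.≤ h ℤ.+ dy s) × StaysAboveEndsOnAxis (h ℤ.+ dy s) ss

IsKnightPath : ∀ {m} → Vec Step m → Set
IsKnightPath p = StaysAboveEndsOnAxis (+ 0) p

Zigzag : ∀ {m} → Vec Step m → Set
Zigzag []           = ⊤
Zigzag (s ∷ [])     = ⊤
Zigzag (s ∷ t ∷ ss) = (isUp s ≢ isUp t) × Zigzag (t ∷ ss)

IsZigzagKnightPath : ∀ {m} → Vec Step m → Set
IsZigzagKnightPath p = IsKnightPath p × Zigzag p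

-- Catalan number C_{n+1} = 1/(n+2) * binom(2n+2, n+1)  (the division is exact)
catalanShift : ℕ → ℕ
catalanShift n = ((2 * n + 2) C (n + 1)) / suc (suc n)

-- A zigzag knight's path starts on the axis, so its first step is an up-step, and it splits
-- into up-down pairs: NN̄ and EĒ keep the height, NĒ raises it by one and EN̄ lowers it by one.
-- Zigzag paths of length 2n are therefore bicoloured Motzkin paths of length n, and a path of
-- odd length would end with an up-step, strictly above the axis. The bicoloured Motzkin paths
-- of length n from height h down to the axis are counted by C(2n, n+h) − C(2n, n+h+2), which
-- matches their first-step recurrence by Pascal's rule applied twice; at h = 0 the absorption
-- identity turns C(2n, n) − C(2n, n+2) into C(2n+2, n+1)/(n+2).
module Submission where

open import Defs
open import Data.Nat using (ℕ; zero; suc; _+_; _*_; z≤n)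
open import Data.Nat.Properties
  using ( +-suc; +-comm; +-assoc; +-identityʳ; *-identityʳ; *-zeroʳ; *-distribˡ-+; +-cancelˡ-≡
        ; m≤m+n; m+n∸m≡n; m+n∸n≡m; m≤n+m; m+1+n≢0)
open import Data.Nat.Combinatorics using (_C_; nCk+nC[k+1]≡[n+1]C[k+1]; nCk≡nC[n∸k]; nC1≡n)
open import Data.Nat.DivMod using (_/_; m*n/n≡m)
open import Data.Nat.Tactic.RingSolver using (solve)
open import Data.Integer as ℤ using (+_; _⊖_; +≤+)
import Data.Integer.Properties as ℤ
open import Data.Bool using (true; false)
open import Data.Fin using (Fin; zero)
open import Data.Fin.Properties using (+↔⊎)
open import Data.Vec using (Vec; []; _∷_)
open import Data.List using (List; []; _∷_)
open import Data.Product using (Σ; _×_; _,_; proj₁; proj₂; map)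
open import Data.Product.Properties using (Σ-≡,≡→≡)
open import Data.Product.Function.Dependent.Propositional using (congˡ)
open import Data.Sum using (_⊎_; inj₁; inj₂)
open import Data.Sum.Function.Propositional using (_⊎-↔_)
open import Data.Unit using (tt)
open import Data.Empty using (⊥-elim)
open import Function using (_∘_; _∋_)
open import Function.Bundles using (_↔_; mk↔ₛ′; Inverse)
open import Function.Properties.Inverse using (↔-trans)
open import Relation.Nullary using (¬_)
open import Relation.Nullary.Irrelevant using (Irrelevant)
open import Relation.Binary.PropositionalEquality
open import Axiom.UniquenessOfIdentityProofs using (module Decidable⇒UIP)
open ≡-Reasoning

variable
  m h : ℕ

double : ℕ → ℕ
double zero    = zero
double (suc n) = suc (suc (double n))

n+n≡double : ∀ n → n + n ≡ double n
n+n≡double zero    = refl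
n+n≡double (suc n) = cong suc (trans (+-suc n n) (cong suc (n+n≡double n)))

2*n≡double : ∀ n → 2 * n ≡ double n
2*n≡double n = trans (cong (λ x → n + x) (+-identityʳ n)) (n+n≡double n)

-- Binomial coefficients

k+j≡n⇒nCk≡nCj : ∀ k j {n} → k + j ≡ n → n C k ≡ n C j
k+j≡n⇒nCk≡nCj k j refl = trans (nCk≡nC[n∸k] (m≤m+n k j)) (cong ((k + j) C_) (m+n∸m≡n k j))

pascal² : ∀ n k → (n C k + n C suc k) + (n C suc k + n C (2 + k)) ≡ (2 + n) C (2 + k)
pascal² n k = trans (cong₂ _+_ (nCk+nC[k+1]≡[n+1]C[k+1] n k) (nCk+nC[k+1]≡[n+1]C[k+1] n (suc k)))
                    (nCk+nC[k+1]≡[n+1]C[k+1] (suc n) (suc k))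

[1+k]*[1+n]C[1+k]≡[1+n]*nCk : ∀ n k → suc k * (suc n C suc k) ≡ suc n * (n C k)
[1+k]*[1+n]C[1+k]≡[1+n]*nCk zero    zero    = refl
[1+k]*[1+n]C[1+k]≡[1+n]*nCk zero    (suc k) = *-zeroʳ (2 + k)
[1+k]*[1+n]C[1+k]≡[1+n]*nCk (suc n) zero    =
  trans (+-identityʳ _) (trans (nC1≡n (2 + n)) (sym (*-identityʳ (2 + n))))
[1+k]*[1+n]C[1+k]≡[1+n]*nCk (suc n) (suc k) = begin
  suc (suc k) * (suc (suc n) C suc (suc k))
    ≡⟨ cong (suc (suc k) *_) (sym (nCk+nC[k+1]≡[n+1]C[k+1] (suc n) (suc k))) ⟩
  suc (suc k) * (P + Q)
    ≡⟨ *-distribˡ-+ (suc (suc k)) P Q ⟩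
  (P + suc k * P) + suc (suc k) * Q
    ≡⟨ cong₂ (λ a b → (P + a) + b) ([1+k]*[1+n]C[1+k]≡[1+n]*nCk n k)
                                    ([1+k]*[1+n]C[1+k]≡[1+n]*nCk n (suc k)) ⟩
  (P + suc n * (n C k)) + suc n * (n C suc k)
    ≡⟨ +-assoc P _ _ ⟩
  P + (suc n * (n C k) + suc n * (n C suc k))
    ≡⟨ cong (λ x → P + x) (sym (*-distribˡ-+ (suc n) (n C k) (n C suc k))) ⟩
  P + suc n * (n C k + n C suc k)
    ≡⟨ cong (λ a → P + suc n * a) (nCk+nC[k+1]≡[n+1]C[k+1] n k) ⟩
  suc (suc n) * P
    ∎
  where
  P = suc n C suc k
  Q = suc n C suc (suc k)

-- Bicoloured Motzkin paths

-- Motzkin₂ m h: bicoloured Motzkin paths from height h down to the axis, indexed by the number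
-- m of knight steps they stand for (two per Motzkin step).
data Motzkin₂ : ℕ → ℕ → Set where
  []      : Motzkin₂ 0 0
  NN̄ EĒ : Motzkin₂ m h → Motzkin₂ (2 + m) h
  NĒ     : Motzkin₂ m (suc h) → Motzkin₂ (2 + m) h
  EN̄     : Motzkin₂ m h → Motzkin₂ (2 + m) (suc h)

motzkin₂ : ℕ → ℕ → ℕ
motzkin₂ zero          zero    = 1
motzkin₂ zero          (suc h) = 0
motzkin₂ (suc zero)    h       = 0
motzkin₂ (suc (suc m)) zero    = motzkin₂ m 0 + (motzkin₂ m 0 + motzkin₂ m 1)
motzkin₂ (suc (suc m)) (suc h) =
  motzkin₂ m (suc h) + (motzkin₂ m (suc h) + (motzkin₂ m (2 + h) + motzkin₂ m h))

Motzkin₂-unfold-zero : (Motzkin₂ m 0 ⊎ (Motzkin₂ m 0 ⊎ Motzkin₂ m 1)) ↔ Motzkin₂ (2 + m) 0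
Motzkin₂-unfold-zero = mk↔ₛ′
  (λ { (inj₁ w) → NN̄ w ; (inj₂ (inj₁ w)) → EĒ w ; (inj₂ (inj₂ w)) → NĒ w })
  (λ { (NN̄ w) → inj₁ w ; (EĒ w) → inj₂ (inj₁ w) ; (NĒ w) → inj₂ (inj₂ w) })
  (λ { (NN̄ w) → refl ; (EĒ w) → refl ; (NĒ w) → refl })
  (λ { (inj₁ w) → refl ; (inj₂ (inj₁ w)) → refl ; (inj₂ (inj₂ w)) → refl })

Motzkin₂-unfold-suc :
  (Motzkin₂ m (suc h) ⊎ (Motzkin₂ m (suc h) ⊎ (Motzkin₂ m (2 + h) ⊎ Motzkin₂ m h)))
    ↔ Motzkin₂ (2 + m) (suc h)
Motzkin₂-unfold-suc = mk↔ₛ′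
  (λ { (inj₁ w) → NN̄ w ; (inj₂ (inj₁ w)) → EĒ w
     ; (inj₂ (inj₂ (inj₁ w))) → NĒ w ; (inj₂ (inj₂ (inj₂ w))) → EN̄ w })
  (λ { (NN̄ w) → inj₁ w ; (EĒ w) → inj₂ (inj₁ w)
     ; (NĒ w) → inj₂ (inj₂ (inj₁ w)) ; (EN̄ w) → inj₂ (inj₂ (inj₂ w)) })
  (λ { (NN̄ w) → refl ; (EĒ w) → refl ; (NĒ w) → refl ; (EN̄ w) → refl })
  (λ { (inj₁ w) → refl ; (inj₂ (inj₁ w)) → refl
     ; (inj₂ (inj₂ (inj₁ w))) → refl ; (inj₂ (inj₂ (inj₂ w))) → refl })

+↔⊎-cong : ∀ {a b} {A B : Set} → Fin a ↔ A → Fin b ↔ B → Fin (a + b) ↔ (A ⊎ B)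
+↔⊎-cong f g = ↔-trans +↔⊎ (f ⊎-↔ g)

Fin-motzkin₂↔Motzkin₂ : ∀ m h → Fin (motzkin₂ m h) ↔ Motzkin₂ m h
Fin-motzkin₂↔Motzkin₂ zero          zero    =
  mk↔ₛ′ (λ _ → []) (λ _ → zero) (λ { [] → refl }) (λ { zero → refl })
Fin-motzkin₂↔Motzkin₂ zero          (suc h) = mk↔ₛ′ (λ ()) (λ ()) (λ ()) (λ ())
Fin-motzkin₂↔Motzkin₂ (suc zero)    h       = mk↔ₛ′ (λ ()) (λ ()) (λ ()) (λ ())
Fin-motzkin₂↔Motzkin₂ (suc (suc m)) zero    = ↔-trans
  (+↔⊎-cong (Fin-motzkin₂↔Motzkin₂ m 0)
    (+↔⊎-cong (Fin-motzkin₂↔Motzkin₂ m 0) (Fin-motzkin₂↔Motzkin₂ m 1)))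
  Motzkin₂-unfold-zero
Fin-motzkin₂↔Motzkin₂ (suc (suc m)) (suc h) = ↔-trans
  (+↔⊎-cong (Fin-motzkin₂↔Motzkin₂ m (suc h))
    (+↔⊎-cong (Fin-motzkin₂↔Motzkin₂ m (suc h))
      (+↔⊎-cong (Fin-motzkin₂↔Motzkin₂ m (2 + h)) (Fin-motzkin₂↔Motzkin₂ m h))))
  Motzkin₂-unfold-suc

¬Motzkin₂-odd : ∀ n → ¬ Motzkin₂ (suc (double n)) h
¬Motzkin₂-odd zero    ()
¬Motzkin₂-odd (suc n) (NN̄ w) = ¬Motzkin₂-odd n w
¬Motzkin₂-odd (suc n) (EĒ w) = ¬Motzkin₂-odd n w
¬Motzkin₂-odd (suc n) (NĒ w) = ¬Motzkin₂-odd n w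
¬Motzkin₂-odd (suc n) (EN̄ w) = ¬Motzkin₂-odd n w

-- The ballot formula motzkin₂ (2n) h = C(2n, h+n) − C(2n, h+n+2), free of subtraction.
motzkin₂-ballot : ∀ n h → motzkin₂ (double n) h + double n C (2 + (h + n)) ≡ double n C (h + n)
motzkin₂-ballot zero            zero    = refl
motzkin₂-ballot zero            (suc h) = refl
motzkin₂-ballot (suc zero)      zero    = refl
motzkin₂-ballot (suc n@(suc m)) zero    = begin
  motzkin₂ (2 + D) 0 + (2 + D) C (3 + n)
    ≡⟨ cong (λ x → motzkin₂ (2 + D) 0 + x) (sym (pascal² D (1 + n))) ⟩
  (c 0 + (c 0 + c 1)) + ((b (1 + n) + b (2 + n)) + (b (2 + n) + b (3 + n)))
    ≡⟨ on-axis {c 0} {c 1} (motzkin₂-ballot n 0) (motzkin₂-ballot n 1) b[m]≡b[2+m] ⟩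
  (b m + b n) + (b n + b (1 + n))
    ≡⟨ pascal² D m ⟩
  (2 + D) C (1 + n)
    ∎
  where
  D = double n
  b = D C_
  c = motzkin₂ D
  b[m]≡b[2+m] : b m ≡ b (2 + m)
  b[m]≡b[2+m] = k+j≡n⇒nCk≡nCj m (2 + m) (trans (+-suc m (suc m)) (n+n≡double n))
  -- EN̄ is missing on the axis; its term is replaced by the symmetry C(2n, n−1) = C(2n, n+1).
  on-axis : ∀ {c₀ c₁ x₋₁ x₀ x₁ x₂ x₃} → c₀ + x₂ ≡ x₀ → c₁ + x₃ ≡ x₁ → x₋₁ ≡ x₁ →
            (c₀ + (c₀ + c₁)) + ((x₁ + x₂) + (x₂ + x₃)) ≡ (x₋₁ + x₀) + (x₀ + x₁)
  on-axis {c₀} {c₁} {x₂ = x₂} {x₃} refl refl refl =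
    -- `List ℕ ∋` resolves the constructors, which are overloaded with those of Vec.
    solve (List ℕ ∋ c₀ ∷ c₁ ∷ x₂ ∷ x₃ ∷ [])
motzkin₂-ballot (suc n) (suc h) rewrite +-suc h n = begin
  motzkin₂ (2 + D) (suc h) + (2 + D) C (4 + k)
    ≡⟨ cong (λ x → motzkin₂ (2 + D) (suc h) + x) (sym (pascal² D (2 + k))) ⟩
  (c (1 + h) + (c (1 + h) + (c (2 + h) + c h)))
    + ((b (2 + k) + b (3 + k)) + (b (3 + k) + b (4 + k)))
    ≡⟨ off-axis {c h} {c (1 + h)} {c (2 + h)}
                (motzkin₂-ballot n h) (motzkin₂-ballot n (1 + h)) (motzkin₂-ballot n (2 + h)) ⟩
  (b k + b (1 + k)) + (b (1 + k) + b (2 + k))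
    ≡⟨ pascal² D k ⟩
  (2 + D) C (2 + k)
    ∎
  where
  D = double n
  b = D C_
  c = motzkin₂ D
  k = h + n
  off-axis : ∀ {c₀ c₁ c₂ x₀ x₁ x₂ x₃ x₄} → c₀ + x₂ ≡ x₀ → c₁ + x₃ ≡ x₁ → c₂ + x₄ ≡ x₂ →
             (c₁ + (c₁ + (c₂ + c₀))) + ((x₂ + x₃) + (x₃ + x₄)) ≡ (x₀ + x₁) + (x₁ + x₂)
  off-axis {c₀} {c₁} {c₂} {x₃ = x₃} {x₄} refl refl refl =
    solve (List ℕ ∋ c₀ ∷ c₁ ∷ c₂ ∷ x₃ ∷ x₄ ∷ [])

[2n+2]C[n+1]≡motzkin₂*[2+n] : ∀ n → (2 * n + 2) C (n + 1) ≡ motzkin₂ (double n) 0 * (2 + n)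
[2n+2]C[n+1]≡motzkin₂*[2+n] n = begin
  (2 * n + 2) C (n + 1)   ≡⟨ cong₂ _C_ 2n+2≡2+D (+-comm n 1) ⟩
  (2 + D) C suc n         ≡⟨ nCk+nC[k+1]≡[n+1]C[k+1] (suc D) n ⟨
  suc D C n + X           ≡⟨ cong (_+ X) (k+j≡n⇒nCk≡nCj n (suc n) n+[1+n]≡1+D) ⟩
  X + X                   ≡⟨ twice-x X≡c+Y (subst (λ d → (2 + n) * (X + Y) ≡ (2 + d) * X) D≡n+n absorb) ⟩
  c * (2 + n)             ∎
  where
  D = double n
  b = D C_
  c = motzkin₂ D 0
  X = suc D C suc n
  Y = suc D C (2 + n)
  D≡n+n : D ≡ n + n
  D≡n+n = sym (n+n≡double n)
  2n+2≡2+D : 2 * n + 2 ≡ 2 + D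
  2n+2≡2+D = trans (+-comm (2 * n) 2) (cong (λ d → 2 + d) (2*n≡double n))
  n+[1+n]≡1+D : n + suc n ≡ suc D
  n+[1+n]≡1+D = trans (+-suc n n) (cong suc (n+n≡double n))
  X≡c+Y : X ≡ c + Y
  X≡c+Y = begin
    X                             ≡⟨ nCk+nC[k+1]≡[n+1]C[k+1] D n ⟨
    b n + b (1 + n)               ≡⟨ cong (_+ b (1 + n)) (motzkin₂-ballot n 0) ⟨
    (c + b (2 + n)) + b (1 + n)   ≡⟨ +-assoc c (b (2 + n)) (b (1 + n)) ⟩
    c + (b (2 + n) + b (1 + n))   ≡⟨ cong (λ x → c + x) (+-comm (b (2 + n)) (b (1 + n))) ⟩
    c + (b (1 + n) + b (2 + n))   ≡⟨ cong (λ x → c + x) (nCk+nC[k+1]≡[n+1]C[k+1] D (suc n)) ⟩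
    c + Y                         ∎
  absorb : (2 + n) * (X + Y) ≡ (2 + D) * X
  absorb = trans (cong ((2 + n) *_) (nCk+nC[k+1]≡[n+1]C[k+1] (suc D) (suc n)))
                 ([1+k]*[1+n]C[1+k]≡[1+n]*nCk (suc D) (suc n))
  -- Absorption says (2 + n) y = n x, which for x = a + y is 2y = n a.
  twice-x : ∀ {a x y} → x ≡ a + y → (2 + n) * (x + y) ≡ (2 + (n + n)) * x → x + x ≡ a * (2 + n)
  twice-x {a} {y = y} refl absorption = begin
    (a + y) + (a + y)   ≡⟨ solve (List ℕ ∋ a ∷ y ∷ []) ⟩
    (a + a) + (y + y)   ≡⟨ cong (λ z → (a + a) + z) 2y≡na ⟩
    (a + a) + n * a     ≡⟨ solve (List ℕ ∋ n ∷ a ∷ []) ⟩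
    a * (2 + n)         ∎
    where
    2y≡na : y + y ≡ n * a
    2y≡na = +-cancelˡ-≡ _ (y + y) (n * a) (begin
      ((a + a) + n * a + (y + y) + n * (y + y)) + (y + y)   ≡⟨ solve (List ℕ ∋ n ∷ a ∷ y ∷ []) ⟩
      (2 + n) * ((a + y) + y)                               ≡⟨ absorption ⟩
      (2 + (n + n)) * (a + y)                               ≡⟨ solve (List ℕ ∋ n ∷ a ∷ y ∷ []) ⟩
      ((a + a) + n * a + (y + y) + n * (y + y)) + n * a     ∎)

motzkin₂≡catalanShift : ∀ n → motzkin₂ (double n) 0 ≡ catalanShift n
motzkin₂≡catalanShift n = begin
  motzkin₂ (double n) 0
    ≡⟨ m*n/n≡m _ (2 + n) ⟨
  motzkin₂ (double n) 0 * (2 + n) / (2 + n)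
    ≡⟨ cong (_/ (2 + n)) ([2n+2]C[n+1]≡motzkin₂*[2+n] n) ⟨
  ((2 * n + 2) C (n + 1)) / (2 + n)
    ∎

-- Zigzag knight's paths

StaysAboveEndsOnAxis-irrelevant : ∀ a (p : Vec Step m) → Irrelevant (StaysAboveEndsOnAxis a p)
StaysAboveEndsOnAxis-irrelevant a []       x        y        = Decidable⇒UIP.≡-irrelevant ℤ._≟_ x y
StaysAboveEndsOnAxis-irrelevant a (s ∷ p) (x₁ , x₂) (y₁ , y₂) =
  cong₂ _,_ (ℤ.≤-irrelevant x₁ y₁) (StaysAboveEndsOnAxis-irrelevant _ p x₂ y₂)

-- Proofs of _≢_ are definitionally equal: ⊥ is a proof-irrelevant record in the standard library.
Zigzag-irrelevant : (p : Vec Step m) → Irrelevant (Zigzag p)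
Zigzag-irrelevant []          _         _         = refl
Zigzag-irrelevant (s ∷ [])    _         _         = refl
Zigzag-irrelevant (s ∷ t ∷ p) (x₁ , x₂) (_ , y₂) = cong (x₁ ,_) (Zigzag-irrelevant (t ∷ p) x₂ y₂)

IsZigzagKnightPath-irrelevant : (p : Vec Step m) → Irrelevant (IsZigzagKnightPath p)
IsZigzagKnightPath-irrelevant p (x₁ , x₂) (y₁ , y₂) =
  cong₂ _,_ (StaysAboveEndsOnAxis-irrelevant _ p x₁ y₁) (Zigzag-irrelevant p x₂ y₂)

Zigzag-tail : ∀ s (p : Vec Step m) → Zigzag (s ∷ p) → Zigzag p
Zigzag-tail s []      _       = tt
Zigzag-tail s (t ∷ p) (_ , z) = z

Zigzag-head : ∀ {s t} → isUp s ≡ isUp t → (p : Vec Step m) → Zigzag (s ∷ p) → Zigzag (t ∷ p)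
Zigzag-head s≡t []      _           = tt
Zigzag-head s≡t (u ∷ p) (s≢u , z) = (λ t≡u → s≢u (trans s≡t t≡u)) , z

-- The sentinel Ē makes Zigzag (Ē ∷ p) say that p zigzags and starts with an up-step.
record ZigzagFrom (h : ℕ) (p : Vec Step m) : Set where
  constructor zigzagFrom
  field
    stays  : StaysAboveEndsOnAxis (+ h) p
    zigzag : Zigzag (Ē ∷ p)

ZigzagFrom-irrelevant : ∀ h (p : Vec Step m) → Irrelevant (ZigzagFrom h p)
ZigzagFrom-irrelevant h p (zigzagFrom x₁ x₂) (zigzagFrom y₁ y₂) =
  cong₂ zigzagFrom (StaysAboveEndsOnAxis-irrelevant _ p x₁ y₁) (Zigzag-irrelevant (Ē ∷ p) x₂ y₂)

ZigzagFrom-zero↔IsZigzagKnightPath : (p : Vec Step m) → ZigzagFrom 0 p ↔ IsZigzagKnightPath p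
ZigzagFrom-zero↔IsZigzagKnightPath p = mk↔ₛ′
  (λ (zigzagFrom stays z) → stays , Zigzag-tail Ē p z)
  (λ (stays , z) → zigzagFrom stays (starts-up p stays z))
  (λ _ → IsZigzagKnightPath-irrelevant p _ _)
  (λ _ → ZigzagFrom-irrelevant 0 p _ _)
  where
  starts-up : (p : Vec Step m) → IsKnightPath p → Zigzag p → Zigzag (Ē ∷ p)
  starts-up []      _        _ = tt
  starts-up (N ∷ p) _        z = (λ ()) , z
  starts-up (E ∷ p) _        z = (λ ()) , z
  starts-up (N̄ ∷ p) (() , _) _
  starts-up (Ē ∷ p) (() , _) _

m+n⊖n≡m : ∀ m n → (m + n) ⊖ n ≡ + m
m+n⊖n≡m m n = trans (ℤ.≤-⊖ (m≤n+m n m)) (cong +_ (m+n∸n≡m m n))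

height-NN̄ : ∀ h → + h ℤ.+ dy N ℤ.+ dy N̄ ≡ + h
height-NN̄ h = m+n⊖n≡m h 2

height-EĒ : ∀ h → + h ℤ.+ dy E ℤ.+ dy Ē ≡ + h
height-EĒ h = m+n⊖n≡m h 1

height-NĒ : ∀ h → + h ℤ.+ dy N ℤ.+ dy Ē ≡ + suc h
height-NĒ h = trans (cong (_⊖ 1) (+-suc h 1)) (m+n⊖n≡m (suc h) 1)

height-EN̄ : ∀ h → + suc h ℤ.+ dy E ℤ.+ dy N̄ ≡ + h
height-EN̄ h = trans (cong (_⊖ 2) (sym (+-suc h 1))) (m+n⊖n≡m h 2)

up-step-nonnegative : ∀ {s} h → isUp s ≡ true → + 0 ℤ.≤ + h ℤ.+ dy s
up-step-nonnegative {N} h _ = +≤+ z≤n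
up-step-nonnegative {E} h _ = +≤+ z≤n

ZigzagFrom-cons₂ : ∀ {h h′ s t} {q : Vec Step m} → isUp s ≡ true → isUp t ≡ false →
                   + h ℤ.+ dy s ℤ.+ dy t ≡ + h′ → ZigzagFrom h′ q → ZigzagFrom h (s ∷ t ∷ q)
ZigzagFrom-cons₂ {h = h} {q = q} s-up t-down height (zigzagFrom stays z) = zigzagFrom
  (up-step-nonnegative h s-up , subst (+ 0 ℤ.≤_) (sym height) (+≤+ z≤n)
    , subst (λ a → StaysAboveEndsOnAxis a q) (sym height) stays)
  (subst (false ≢_) (sym s-up) (λ ()) , subst₂ _≢_ (sym s-up) (sym t-down) (λ ())
    , Zigzag-head (sym t-down) q z)

ZigzagFrom-tail₂ : ∀ {h h′ s t} {q : Vec Step m} → isUp t ≡ false →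
                   + h ℤ.+ dy s ℤ.+ dy t ≡ + h′ → ZigzagFrom h (s ∷ t ∷ q) → ZigzagFrom h′ q
ZigzagFrom-tail₂ {q = q} t-down height (zigzagFrom (_ , _ , stays) (_ , _ , z)) =
  zigzagFrom (subst (λ a → StaysAboveEndsOnAxis a q) height stays) (Zigzag-head t-down q z)

steps : Motzkin₂ m h → Vec Step m
steps []     = []
steps (NN̄ w) = N ∷ N̄ ∷ steps w
steps (EĒ w) = E ∷ Ē ∷ steps w
steps (NĒ w) = N ∷ Ē ∷ steps w
steps (EN̄ w) = E ∷ N̄ ∷ steps w

steps-zigzag : (w : Motzkin₂ m h) → ZigzagFrom h (steps w)
steps-zigzag []                 = zigzagFrom refl tt
steps-zigzag {h = h} (NN̄ w)     = ZigzagFrom-cons₂ refl refl (height-NN̄ h) (steps-zigzag w)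
steps-zigzag {h = h} (EĒ w)     = ZigzagFrom-cons₂ refl refl (height-EĒ h) (steps-zigzag w)
steps-zigzag {h = h} (NĒ w)     = ZigzagFrom-cons₂ refl refl (height-NĒ h) (steps-zigzag w)
steps-zigzag {h = suc h} (EN̄ w) = ZigzagFrom-cons₂ refl refl (height-EN̄ h) (steps-zigzag w)

parse : (p : Vec Step m) → ZigzagFrom h p → Σ (Motzkin₂ m h) (λ w → steps w ≡ p)
parse {h = h}     (N ∷ N̄ ∷ q) v =
  map NN̄ (cong (λ r → N ∷ N̄ ∷ r)) (parse q (ZigzagFrom-tail₂ refl (height-NN̄ h) v))
parse {h = h}     (E ∷ Ē ∷ q) v =
  map EĒ (cong (λ r → E ∷ Ē ∷ r)) (parse q (ZigzagFrom-tail₂ refl (height-EĒ h) v))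
parse {h = h}     (N ∷ Ē ∷ q) v =
  map NĒ (cong (λ r → N ∷ Ē ∷ r)) (parse q (ZigzagFrom-tail₂ refl (height-NĒ h) v))
parse {h = suc h} (E ∷ N̄ ∷ q) v =
  map EN̄ (cong (λ r → E ∷ N̄ ∷ r)) (parse q (ZigzagFrom-tail₂ refl (height-EN̄ h) v))
parse {h = zero}  (E ∷ N̄ ∷ q) (zigzagFrom (_ , () , _) _)
parse {h = zero}  []            _                               = [] , refl
parse {h = suc h} []            (zigzagFrom () _)
parse             (N ∷ [])      (zigzagFrom (_ , on-axis) _)   = ⊥-elim (m+1+n≢0 _ (ℤ.+-injective on-axis))
parse             (E ∷ [])      (zigzagFrom (_ , on-axis) _)   = ⊥-elim (m+1+n≢0 _ (ℤ.+-injective on-axis))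
parse             (N̄ ∷ _)       (zigzagFrom _ (Ē≢N̄ , _))      = ⊥-elim (Ē≢N̄ refl)
parse             (Ē ∷ _)       (zigzagFrom _ (Ē≢Ē , _))      = ⊥-elim (Ē≢Ē refl)
parse             (N ∷ N ∷ _)   (zigzagFrom _ (_ , N≢N , _))  = ⊥-elim (N≢N refl)
parse             (N ∷ E ∷ _)   (zigzagFrom _ (_ , N≢E , _))  = ⊥-elim (N≢E refl)
parse             (E ∷ N ∷ _)   (zigzagFrom _ (_ , E≢N , _))  = ⊥-elim (E≢N refl)
parse             (E ∷ E ∷ _)   (zigzagFrom _ (_ , E≢E , _))  = ⊥-elim (E≢E refl)

parse-steps : (w : Motzkin₂ m h) (v : ZigzagFrom h (steps w)) → proj₁ (parse (steps w) v) ≡ w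
parse-steps []     _ = refl
parse-steps (NN̄ w) _ = cong NN̄ (parse-steps w _)
parse-steps (EĒ w) _ = cong EĒ (parse-steps w _)
parse-steps (NĒ w) _ = cong NĒ (parse-steps w _)
parse-steps (EN̄ w) _ = cong EN̄ (parse-steps w _)

Motzkin₂↔ZigzagFrom : Motzkin₂ m h ↔ Σ (Vec Step m) (ZigzagFrom h)
Motzkin₂↔ZigzagFrom {h = h} = mk↔ₛ′
  (λ w → steps w , steps-zigzag w)
  (λ (p , v) → proj₁ (parse p v))
  (λ (p , v) → Σ-≡,≡→≡ (proj₂ (parse p v) , ZigzagFrom-irrelevant h p _ _))
  (λ w → parse-steps w _)

Motzkin₂↔zigzagKnightPaths : Motzkin₂ m 0 ↔ Σ (Vec Step m) IsZigzagKnightPath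
Motzkin₂↔zigzagKnightPaths =
  ↔-trans Motzkin₂↔ZigzagFrom (congˡ (ZigzagFrom-zero↔IsZigzagKnightPath _))

corollary3 : ((n : ℕ) → ¬ Σ (Vec Step (2 * n + 1)) IsZigzagKnightPath)
    × ((n : ℕ) → Fin (catalanShift n) ↔ Σ (Vec Step (2 * n)) IsZigzagKnightPath)
corollary3 = odd-length , even-length
  where
  odd-length : (n : ℕ) → ¬ Σ (Vec Step (2 * n + 1)) IsZigzagKnightPath
  odd-length n rewrite +-comm (2 * n) 1 | 2*n≡double n =
    ¬Motzkin₂-odd n ∘ Inverse.from Motzkin₂↔zigzagKnightPaths
  even-length : (n : ℕ) → Fin (catalanShift n) ↔ Σ (Vec Step (2 * n)) IsZigzagKnightPath
  even-length n =
    subst₂ (λ k l → Fin k ↔ Σ (Vec Step l) IsZigzagKnightPath)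
           (motzkin₂≡catalanShift n) (sym (2*n≡double n))
      (↔-trans (Fin-motzkin₂↔Motzkin₂ (double n) 0) Motzkin₂↔zigzagKnightPaths)
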